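{- Let $n$ be even. Suppose $(a',b')$ is a pair of integers with $1 \le a' < b' < n$ such that the generalized cyclic table $\mathscr{C}(n,a',b')$ has two columns $A \neq B$ with $|A \cap B| = 3$. Then $(a',b')$ is the centroid of the triangle in the $(a,b)$-plane bounded by the lines $n = 2b-2a$, $n = 2a$, and $n = 2b$. Moreover, $(a',b')$ satisfies each of the equations $n = a+b$, $n = 2b-a$, and $2a = b$.
   Context: The generalized cyclic table $\mathscr{C}(n,a,b)$, for $1 \le a < b < n$, has points $1,\dots,n$ (taken mod $n$). It has $n$ columns, the $j$-th being the ordered triple $[j,\ j+a,\ j+b]$ for $j=1,\dots,n$, with entries reduced mod $n$. Two columns are equal if they agree entrywise. $|A\cap B|$ denotes the number of points common to the underlying sets of entries of $A$ and $B$. -}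

module Defs where

open import Data.Nat using (ℕ; zero; suc; _+_; _*_; _≟_)
open import Data.Nat.DivMod using (_%_; _/_)
open import Data.Fin using (Fin; toℕ)
open import Data.Product using (_×_; _,_)
open import Data.List using (List; _∷_; []; length; filter; upTo)
open import Data.List.Membership.DecPropositional _≟_ using (_∈?_)
open import Relation.Nullary.Decidable using (_×-dec_)
open import Relation.Binary.PropositionalEquality using (_≡_)

-- reduction mod n (points are represented by residues 0 … n-1)
red : ℕ → ℕ → ℕ
red x zero    = x
red x (suc k) = x % suc k

Column : Set
Column = ℕ × ℕ × ℕ

column : (n a b : ℕ) → Fin n → Column
column n a b j = red (toℕ j) n , red (toℕ j + a) n , red (toℕ j + b) n

entries : Column → List ℕ
entries (x , y , z) = x ∷ y ∷ z ∷ []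

common : ℕ → Column → Column → ℕ
common n A B = length (filter (λ p → (p ∈? entries A) ×-dec (p ∈? entries B)) (upTo n))

-- Triangle bounded by the lines n = 2b - 2a, n = 2a, n = 2b (n even).
-- Its vertices:  n=2a ∩ n=2b : (n/2, n/2);  n=2a ∩ n=2b-2a : (n/2, n);
--                n=2b ∩ n=2b-2a : (0, n/2).
half : ℕ → ℕ
half n = n / 2

-- (a , b) is the centroid of the triangle: 3·(a,b) = sum of the vertices
IsCentroid : ℕ → ℕ → ℕ → Set
IsCentroid n a b = (3 * a ≡ half n + half n + 0) × (3 * b ≡ half n + n + half n)

-- Write the two columns as [x, x+a, x+b] and [y, y+a, y+b]. Sharing three
-- points, the first column's entries all lie in the second, so x ≡ y + s for an
-- offset s ∈ {a, b} (s = 0 would make the columns equal), and the offset set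
-- {0, a, b} is closed under adding s modulo n. For the other offset t this
-- forces s + t ≡ 0 and 2s ≡ t (mod n), and the size bounds 0 < a < b < n
-- leave only b = 2a and n = a + b = 3a; evenness of n then gives the centroid.
module Submission where

open import Defs
open import Data.Nat using (ℕ; zero; suc; _+_; _*_; _∸_; _≤_; _<_; z≤n; s≤s; _<?_)
open import Data.Nat.Properties
open import Data.Nat.DivMod
open import Data.Nat.Divisibility using (_∣_; ∣-refl)
open import Data.Nat.Tactic.RingSolver using (solve)
open import Data.Fin using (Fin; toℕ)
open import Data.Product using (_×_; ∃₂; _,_)
open import Data.Sum using (_⊎_; inj₁; inj₂; swap; map₂)
open import Data.Empty using (⊥-elim)
open import Data.List using (List; _∷_; []; [_]; length; filter; upTo)
open import Data.List.Relation.Unary.Any using (here; there)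
open import Data.List.Relation.Unary.All using (All; _∷_; [])
import Data.List.Relation.Unary.All as All
open import Data.List.Relation.Unary.All.Properties using (all-filter)
open import Data.List.Relation.Unary.AllPairs using (_∷_)
open import Data.List.Relation.Unary.Unique.Propositional using (Unique)
open import Data.List.Relation.Unary.Unique.Propositional.Properties using (filter⁺; upTo⁺)
open import Data.List.Membership.DecPropositional _≟_ using (_∈?_; _∈_; _∉_)
open import Relation.Nullary using (¬_; Dec; yes; no)
open import Relation.Nullary.Decidable using (_×-dec_)
open import Relation.Binary.PropositionalEquality
  using (_≡_; _≢_; refl; sym; trans; cong; cong₂; module ≡-Reasoning)

open ≡-Reasoning

unique-pair-length : ∀ {u v} (L : List ℕ) → Unique L →
  All (λ p → p ≡ u ⊎ p ≡ v) L → length L ≤ 2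
unique-pair-length []              _ _ = z≤n
unique-pair-length (_ ∷ [])        _ _ = s≤s z≤n
unique-pair-length (_ ∷ _ ∷ [])    _ _ = s≤s (s≤s z≤n)
unique-pair-length (p ∷ q ∷ r ∷ _) ((p≢q ∷ p≢r ∷ _) ∷ (q≢r ∷ _) ∷ _) (p∈ ∷ q∈ ∷ r∈ ∷ _)
  with p∈ | q∈ | r∈
... | inj₁ p≡u | inj₁ q≡u | _        = ⊥-elim (p≢q (trans p≡u (sym q≡u)))
... | inj₂ p≡v | inj₂ q≡v | _        = ⊥-elim (p≢q (trans p≡v (sym q≡v)))
... | inj₁ p≡u | _        | inj₁ r≡u = ⊥-elim (p≢r (trans p≡u (sym r≡u)))
... | inj₂ p≡v | _        | inj₂ r≡v = ⊥-elim (p≢r (trans p≡v (sym r≡v)))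
... | _        | inj₁ q≡u | inj₁ r≡u = ⊥-elim (q≢r (trans q≡u (sym r≡u)))
... | _        | inj₂ q≡v | inj₂ r≡v = ⊥-elim (q≢r (trans q≡v (sym r≡v)))

entries-remove : ∀ {e} (A : Column) → e ∈ entries A →
  ∃₂ λ u v → ∀ {p} → p ∈ entries A → p ≢ e → p ≡ u ⊎ p ≡ v
entries-remove (x , y , z) (here refl) = y , z , λ
  { (here refl) p≢e → ⊥-elim (p≢e refl)
  ; (there (here p≡y)) _ → inj₁ p≡y
  ; (there (there (here p≡z))) _ → inj₂ p≡z }
entries-remove (x , y , z) (there (here refl)) = x , z , λ
  { (here p≡x) _ → inj₁ p≡x
  ; (there (here refl)) p≢e → ⊥-elim (p≢e refl)
  ; (there (there (here p≡z))) _ → inj₂ p≡z }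
entries-remove (x , y , z) (there (there (here refl))) = x , y , λ
  { (here p≡x) _ → inj₁ p≡x
  ; (there (here p≡y)) _ → inj₂ p≡y
  ; (there (there (here refl))) p≢e → ⊥-elim (p≢e refl) }

common≤2 : ∀ n (A B : Column) {e} → e ∈ entries A → e ∉ entries B → common n A B ≤ 2
common≤2 n A B e∈A e∉B with entries-remove A e∈A
... | u , v , other =
  unique-pair-length (filter P? (upTo n)) (filter⁺ P? (upTo⁺ n))
    (All.map (λ { (p∈A , p∈B) → other p∈A (λ { refl → e∉B p∈B }) }) (all-filter P? (upTo n)))
  where
  P? : (p : ℕ) → Dec (p ∈ entries A × p ∈ entries B)
  P? p = (p ∈? entries A) ×-dec (p ∈? entries B)

common≡3⇒entries⊆ : ∀ n (A B : Column) → common n A B ≡ 3 →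
  ∀ {e} → e ∈ entries A → e ∈ entries B
common≡3⇒entries⊆ n A B c≡3 {e} e∈A with e ∈? entries B
... | yes e∈B = e∈B
... | no  e∉B = ⊥-elim (≤⇒≯ (common≤2 n A B e∈A e∉B) (≤-reflexive (sym c≡3)))

∈-triple : ∀ {p α β γ} → p ∈ entries (α , β , γ) → p ≡ α ⊎ p ≡ β ⊎ p ≡ γ
∈-triple (here p≡α)                = inj₁ p≡α
∈-triple (there (here p≡β))        = inj₂ (inj₁ p≡β)
∈-triple (there (there (here p≡γ))) = inj₂ (inj₂ p≡γ)

module Congruence (m : ℕ) where

  N : ℕ
  N = suc m

  infix 4 _≈_
  _≈_ : ℕ → ℕ → Set
  p ≈ q = p % N ≡ q % N

  +-congʳ-≈ : ∀ {p q} c → p ≈ q → p + c ≈ q + c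
  +-congʳ-≈ {p} {q} c p≈q = begin
    (p + c) % N             ≡⟨ %-distribˡ-+ p c N ⟩
    (p % N + c % N) % N     ≡⟨ cong (λ r → (r + c % N) % N) p≈q ⟩
    (q % N + c % N) % N     ≡⟨ %-distribˡ-+ q c N ⟨
    (q + c) % N             ∎

  +-congˡ-≈ : ∀ {p q} c → p ≈ q → c + p ≈ c + q
  +-congˡ-≈ {p} {q} c p≈q = begin
    (c + p) % N  ≡⟨ cong (_% N) (+-comm c p) ⟩
    (p + c) % N  ≡⟨ +-congʳ-≈ {p} {q} c p≈q ⟩
    (q + c) % N  ≡⟨ cong (_% N) (+-comm q c) ⟩
    (c + q) % N  ∎

  suc-cancel-≈ : ∀ {p q} → suc p ≈ suc q → p ≈ q
  suc-cancel-≈ {p} {q} sp≈sq = begin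
    p % N            ≡⟨ N+p≈p p ⟨
    (N + p) % N      ≡⟨ cong (_% N) (+-suc m p) ⟨
    (m + suc p) % N  ≡⟨ +-congˡ-≈ {suc p} {suc q} m sp≈sq ⟩
    (m + suc q) % N  ≡⟨ cong (_% N) (+-suc m q) ⟩
    (N + q) % N      ≡⟨ N+p≈p q ⟩
    q % N            ∎
    where
    N+p≈p : ∀ p → N + p ≈ p
    N+p≈p p = %-remove-+ˡ p (∣-refl {N})

  +-cancelˡ-≈ : ∀ c {p q} → c + p ≈ c + q → p ≈ q
  +-cancelˡ-≈ zero    c+p≈c+q = c+p≈c+q
  +-cancelˡ-≈ (suc c) {p} {q} c+p≈c+q = +-cancelˡ-≈ c (suc-cancel-≈ {c + p} {c + q} c+p≈c+q)

  m+n≈m⇒n≈0 : ∀ {p q} → p + q ≈ p → q ≈ 0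
  m+n≈m⇒n≈0 {p} p+q≈p = +-cancelˡ-≈ p (trans p+q≈p (cong (_% N) (sym (+-identityʳ p))))

  0<v<N⇒v≉0 : ∀ {v} → 0 < v → v < N → ¬ v ≈ 0
  0<v<N⇒v≉0 {v} 0<v v<N v≈0 = <⇒≢ 0<v (sym (trans (sym (m<n⇒m%n≡m v<N)) v≈0))

  ≈⇒≡⊎≡N+ : ∀ {u v} → u < N + N → v < N → u ≈ v → u ≡ v ⊎ u ≡ N + v
  ≈⇒≡⊎≡N+ {u} {v} u<2N v<N u≈v with u <? N
  ... | yes u<N = inj₁ (trans (sym (m<n⇒m%n≡m u<N)) (trans u≈v (m<n⇒m%n≡m v<N)))
  ... | no  u≮N = inj₂ (begin
    u              ≡⟨ m+[n∸m]≡n N≤u ⟨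
    N + (u ∸ N)    ≡⟨ cong (N +_) (m<n⇒m%n≡m (m<n+o⇒m∸n<o u N u<2N)) ⟨
    N + (u ∸ N) % N ≡⟨ cong (N +_) (m≤n⇒[n∸m]%m≡n%m N≤u) ⟩
    N + u % N      ≡⟨ cong (N +_) (trans u≈v (m<n⇒m%n≡m v<N)) ⟩
    N + v          ∎)
    where
    N≤u : N ≤ u
    N≤u = ≮⇒≥ u≮N

  ≈0⇒≡N : ∀ {u} → 0 < u → u < N + N → u ≈ 0 → u ≡ N
  ≈0⇒≡N 0<u u<2N u≈0 with ≈⇒≡⊎≡N+ u<2N (s≤s z≤n) u≈0
  ... | inj₁ u≡0  = ⊥-elim (<⇒≢ 0<u (sym u≡0))
  ... | inj₂ u≡N+0 = trans u≡N+0 (+-identityʳ N)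

  offset-shift : ∀ {x y s u v} → x ≈ y + s → x + u ≈ y + v → s + u ≈ v
  offset-shift {x} {y} {s} {u} {v} x≈y+s x+u≈y+v = +-cancelˡ-≈ y (begin
    (y + (s + u)) % N  ≡⟨ cong (_% N) (+-assoc y s u) ⟨
    (y + s + u) % N    ≡⟨ +-congʳ-≈ {x} {y + s} u x≈y+s ⟨
    (x + u) % N        ≡⟨ x+u≈y+v ⟩
    (y + v) % N        ∎)

  InOffsets : ℕ → ℕ → ℕ → Set
  InOffsets s t w = w ≈ 0 ⊎ w ≈ s ⊎ w ≈ t

  shift-closed-offsets : ∀ {s t} → 0 < s → s < N → 0 < t → t < N → s ≢ t →
    InOffsets s t (s + s) → InOffsets s t (s + t) →
    s + t ≡ N × (t ≡ s + s ⊎ s ≡ t + t)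
  shift-closed-offsets {s} {t} 0<s s<N 0<t t<N s≢t 2s∈ s+t∈ = s+t≡N s+t∈ , doubling 2s∈
    where
    s+t≡N : InOffsets s t (s + t) → s + t ≡ N
    s+t≡N (inj₁ s+t≈0)        = ≈0⇒≡N (<-≤-trans 0<s (m≤m+n s t)) (+-mono-< s<N t<N) s+t≈0
    s+t≡N (inj₂ (inj₁ s+t≈s)) = ⊥-elim (0<v<N⇒v≉0 0<t t<N (m+n≈m⇒n≈0 {s} s+t≈s))
    s+t≡N (inj₂ (inj₂ s+t≈t)) =
      ⊥-elim (0<v<N⇒v≉0 0<s s<N (m+n≈m⇒n≈0 {t} (trans (cong (_% N) (+-comm t s)) s+t≈t)))

    doubling : InOffsets s t (s + s) → t ≡ s + s ⊎ s ≡ t + t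
    doubling (inj₁ 2s≈0) = ⊥-elim (s≢t (+-cancelˡ-≡ s s t
      (trans (≈0⇒≡N (<-≤-trans 0<s (m≤m+n s s)) (+-mono-< s<N s<N) 2s≈0) (sym (s+t≡N s+t∈)))))
    doubling (inj₂ (inj₁ 2s≈s)) = ⊥-elim (0<v<N⇒v≉0 0<s s<N (m+n≈m⇒n≈0 {s} 2s≈s))
    doubling (inj₂ (inj₂ 2s≈t)) with ≈⇒≡⊎≡N+ (+-mono-< s<N s<N) t<N 2s≈t
    ... | inj₁ 2s≡t   = inj₁ (sym 2s≡t)
    ... | inj₂ 2s≡N+t = inj₂ (+-cancelˡ-≡ s s (t + t) (begin
      s + s        ≡⟨ 2s≡N+t ⟩
      N + t        ≡⟨ cong (_+ t) (s+t≡N s+t∈) ⟨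
      s + t + t    ≡⟨ +-assoc s t t ⟩
      s + (t + t)  ∎))

module ColumnPairs (m a b : ℕ) (0<a : 0 < a) (a<b : a < b) (b<N : b < suc m) where
  open Congruence m

  shifted-entry : (j k : Fin N) → ∀ {s} u → toℕ j ≈ toℕ k + s →
    (toℕ j + u) % N ∈ entries (column N a b k) → InOffsets a b (s + u)
  shifted-entry j k {s} u x≈y+s x+u∈B with ∈-triple x+u∈B
  ... | inj₁ x+u≈y         = inj₁ (offset-shift {toℕ j} {toℕ k} {s} {u} x≈y+s
                                     (trans x+u≈y (cong (_% N) (sym (+-identityʳ (toℕ k))))))
  ... | inj₂ (inj₁ x+u≈y+a) = inj₂ (inj₁ (offset-shift {toℕ j} {toℕ k} {s} {u} x≈y+s x+u≈y+a))
  ... | inj₂ (inj₂ x+u≈y+b) = inj₂ (inj₂ (offset-shift {toℕ j} {toℕ k} {s} {u} x≈y+s x+u≈y+b))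

  sharing-three-points : (j k : Fin N) → column N a b j ≢ column N a b k →
    common N (column N a b j) (column N a b k) ≡ 3 → b ≡ a + a × N ≡ a + b
  sharing-three-points j k A≢B common≡3 = by-offset (∈-triple (A⊆B (here refl)))
    where
    x y : ℕ
    x = toℕ j
    y = toℕ k

    A⊆B : ∀ {e} → e ∈ entries (column N a b j) → e ∈ entries (column N a b k)
    A⊆B = common≡3⇒entries⊆ N (column N a b j) (column N a b k) common≡3

    entry-a : (x + a) % N ∈ entries (column N a b k)
    entry-a = A⊆B (there (here refl))

    entry-b : (x + b) % N ∈ entries (column N a b k)
    entry-b = A⊆B (there (there (here refl)))

    a<N : a < N
    a<N = <-trans a<b b<N
    0<b : 0 < b
    0<b = <-trans 0<a a<b
    a≢b+b : a ≢ b + b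
    a≢b+b a≡2b = <⇒≱ a<b (≤-trans (m≤m+n b b) (≤-reflexive (sym a≡2b)))

    by-offset : x ≈ y ⊎ x ≈ y + a ⊎ x ≈ y + b → b ≡ a + a × N ≡ a + b
    by-offset (inj₁ x≈y) =
      ⊥-elim (A≢B (cong₂ _,_ x≈y (cong₂ _,_ (+-congʳ-≈ {x} {y} a x≈y) (+-congʳ-≈ {x} {y} b x≈y))))
    by-offset (inj₂ (inj₁ x≈y+a))
      with shift-closed-offsets 0<a a<N 0<b b<N (<⇒≢ a<b)
             (shifted-entry j k a x≈y+a entry-a) (shifted-entry j k b x≈y+a entry-b)
    ... | a+b≡N , inj₁ b≡2a = b≡2a , sym a+b≡N
    ... | _     , inj₂ a≡2b = ⊥-elim (a≢b+b a≡2b)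
    by-offset (inj₂ (inj₂ x≈y+b))
      with shift-closed-offsets 0<b b<N 0<a a<N (>⇒≢ a<b)
             (map₂ swap (shifted-entry j k b x≈y+b entry-b)) (map₂ swap (shifted-entry j k a x≈y+b entry-a))
    ... | _     , inj₁ a≡2b = ⊥-elim (a≢b+b a≡2b)
    ... | b+a≡N , inj₂ b≡2a = b≡2a , trans (sym b+a≡N) (+-comm b a)

tripled-centroid : ∀ n a h → 2 * h ≡ n → n ≡ a + (a + a) →
  3 * a ≡ h + h + 0 × 3 * (a + a) ≡ h + n + h
tripled-centroid n a h 2h≡n n≡3a = centroid-a , centroid-b
  where
  centroid-a : 3 * a ≡ h + h + 0
  centroid-a = begin
    3 * a          ≡⟨ solve [ a ] ⟩
    a + (a + a)    ≡⟨ n≡3a ⟨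
    n              ≡⟨ 2h≡n ⟨
    2 * h          ≡⟨ solve [ h ] ⟩
    h + h + 0      ∎

  centroid-b : 3 * (a + a) ≡ h + n + h
  centroid-b = begin
    3 * (a + a)          ≡⟨ solve [ a ] ⟩
    2 * (a + (a + a))    ≡⟨ cong (2 *_) n≡3a ⟨
    2 * n                ≡⟨ cong (2 *_) 2h≡n ⟨
    2 * (2 * h)          ≡⟨ solve [ h ] ⟩
    h + 2 * h + h        ≡⟨ cong (λ m → h + m + h) 2h≡n ⟩
    h + n + h            ∎

centroid-of-tripled : ∀ {n a b} → 2 ∣ n → b ≡ a + a → n ≡ a + b →
  IsCentroid n a b × (n ≡ a + b) × (n + a ≡ 2 * b) × (2 * a ≡ b)
centroid-of-tripled {n} {a} 2∣n refl n≡3a =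
  tripled-centroid n a (half n) (m*[n/m]≡n 2∣n) n≡3a , n≡3a , n+a≡2b , solve [ a ]
  where
  n+a≡2b : n + a ≡ 2 * (a + a)
  n+a≡2b = begin
    n + a              ≡⟨ cong (_+ a) n≡3a ⟩
    a + (a + a) + a    ≡⟨ solve [ a ] ⟩
    2 * (a + a)        ∎

mainTheorem8 : (n a b : ℕ) → 2 ∣ n → 1 ≤ a → a < b → b < n →
    ∃₂ (λ (j k : Fin n) → (column n a b j ≢ column n a b k) × (common n (column n a b j) (column n a b k) ≡ 3)) →
    IsCentroid n a b × (n ≡ a + b) × (n + a ≡ 2 * b) × (2 * a ≡ b)
mainTheorem8 zero    _ _ _   _   _   ()
mainTheorem8 (suc m) a b 2∣n 0<a a<b b<n (j , k , A≢B , common≡3) =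
  let b≡2a , n≡a+b = ColumnPairs.sharing-three-points m a b 0<a a<b b<n j k A≢B common≡3
  in  centroid-of-tripled 2∣n b≡2a n≡a+b
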